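{- Let $\rho$ be an integer polymatroid on $E=[n]$ with natural matroid $M_\rho$, and let $\hat{0}_\rho=\{i\in E:\rho(\{i\})=0\}$. For $A\subseteq E$: (1) $\mathrm{cl}_\rho(A)=B$ if and only if $\hat{0}_\rho\subseteq B$ and $\mathrm{cl}_{M_\rho}(X_A)=X_B$; (2) $\mathrm{cl}_\rho(A)=A\cup\hat{0}_\rho\cup C_A$, where $C_A$ is the set of all $i\in E$ for which some circuit $\mathbf{u}$ of $\rho$ has $u_i=1$ and $u_j=0$ for all $j\in E-(A\cup\{i\})$.
   Context: An integer polymatroid on $E=[n]$ is a function $\rho:2^E\to\mathbb{N}$ with $\rho(\emptyset)=0$, monotone and submodular. A subset $F\subseteq E$ is a flat of $\rho$ if $\rho(F\cup\{i\})>\rho(F)$ for all $i\in E-F$; $\mathrm{cl}_\rho(A)$ is the intersection of all flats containing $A$; $\mathrm{cl}_{M}$ is the usual matroid closure. Natural matroid: for each $i\in E$ let $X_i$ be a set of $\rho(\{i\})$ elements, the $X_i$ pairwise disjoint; $X_A=\bigcup_{i\in A}X_i$, $E'=X_E$; $M_\rho$ is the matroid on $E'$ with rank function $r(Y)=\min\{\rho(A)+|Y-X_A|:A\subseteq E\}$. For $\mathbf{u}\in\mathbb{N}^n$, $\mathbf{u}$ is independent if $\sum_{i\in X}u_i\le\rho(X)$ for all $X\subseteq E$. A circuit of $\rho$ is a vector $\mathbf{u}$ with $0\le u_i\le\rho(\{i\})$ for all $i$ that is not independent but every $\mathbf{w}\in\mathbb{N}^n$ with $\mathbf{w}\le\mathbf{u}$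 componentwise and $\mathbf{w}\ne\mathbf{u}$ is independent. -}

module Defs where

open import Data.Nat using (ℕ; zero; suc; _+_; _≤_; _<_; _⊓_)
open import Data.Bool using (Bool; true; false; if_then_else_; _∨_)
open import Data.Fin using (Fin) renaming (zero to fzero; suc to fsuc)
import Data.Fin as Fin
open import Data.Fin.Subset
  using (Subset; _∈_; _∉_; _⊆_; _∪_; _∩_; ⁅_⁆; ⊥; ∁; ∣_∣)
open import Data.Vec using (Vec; []; _∷_; lookup; tabulate)
open import Data.Product using (Σ; _×_; _,_; proj₁; ∃)
open import Data.Product.Properties using (≡-dec)
open import Relation.Binary.PropositionalEquality using (_≡_; _≢_)
open import Relation.Nullary using (¬_; does)

record IsPolymatroid {n : ℕ} (ρ : Subset n → ℕ) : Set where
  field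
    empty-zero  : ρ ⊥ ≡ 0
    monotone    : ∀ A B → A ⊆ B → ρ A ≤ ρ B
    submodular  : ∀ A B → ρ (A ∪ B) + ρ (A ∩ B) ≤ ρ A + ρ B

module _ {n : ℕ} (ρ : Subset n → ℕ) where

  IsFlat : Subset n → Set
  IsFlat F = ∀ i → i ∉ F → ρ F < ρ (F ∪ ⁅ i ⁆)

  _∈clρ_ : Fin n → Subset n → Set
  i ∈clρ A = ∀ F → IsFlat F → A ⊆ F → i ∈ F

  _∈hat0 : Fin n → Set
  i ∈hat0 = ρ ⁅ i ⁆ ≡ 0

  -- Natural matroid M_ρ.  X_i = Fin (ρ {i}); ground set E' = Σ_i X_i
  -- (disjoint union).  Subsets of E' are Bool-valued functions on E'.
  E' : Set
  E' = Σ (Fin n) (λ i → Fin (ρ ⁅ i ⁆))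

  SubE' : Set
  SubE' = E' → Bool

  X : Subset n → SubE'
  X A (i , _) = lookup A i

  insert : E' → SubE' → SubE'
  insert e Y e' = Y e' ∨ does (≡-dec Fin._≟_ Fin._≟_ e' e)

sumS : ∀ {n} → Subset n → (Fin n → ℕ) → ℕ
sumS [] f = 0
sumS (b ∷ S) f = (if b then f fzero else 0) + sumS S (λ i → f (fsuc i))

minOver : ∀ n → (Subset n → ℕ) → ℕ
minOver zero g = g []
minOver (suc n) g = minOver n (λ A → g (false ∷ A)) ⊓ minOver n (λ A → g (true ∷ A))

module _ {n : ℕ} (ρ : Subset n → ℕ) where

  sizeOutside : SubE' ρ → Subset n → ℕ
  sizeOutside Y A = sumS (∁ A) (λ i → ∣ tabulate (λ x → Y (i , x)) ∣)

  rankM : SubE' ρ → ℕ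
  rankM Y = minOver n (λ A → ρ A + sizeOutside Y A)

  _∈clM_ : E' ρ → SubE' ρ → Set
  e ∈clM Y = rankM (insert ρ e Y) ≡ rankM Y

  Independent : (Fin n → ℕ) → Set
  Independent u = ∀ S → sumS S u ≤ ρ S

  IsCircuit : (Fin n → ℕ) → Set
  IsCircuit u =
    (∀ i → u i ≤ ρ ⁅ i ⁆) ×
    ¬ Independent u ×
    (∀ w → (∀ i → w i ≤ u i) → ¬ (∀ i → w i ≡ u i) → Independent w)

  _∈C_ : Fin n → Subset n → Set
  i ∈C A = ∃ λ u → IsCircuit u × u i ≡ 1 × (∀ j → j ∉ A → j ≢ i → u j ≡ 0)

-- Say that A spans i when ρ (A ∪ {i}) = ρ A.  By submodularity the spanned elements form a flat
-- containing A which lies inside every flat containing A, so cl_ρ(A) is exactly the set of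
-- elements spanned by A.
--
-- The rank in M_ρ of Y ⊆ E' depends only on the block counts |Y ∩ X_j|: for X_A it is ρ(A), and one
-- extra element of X_i (i ∉ A) raises it to min(ρ(A ∪ {i}), ρ(A) + 1).  Hence that element lies in
-- cl_M(X_A) iff A spans i, which gives (1).
--
-- For (2), let i ∉ A with ρ({i}) > 0.  If A spans i, take a maximal independent w below the block
-- counts of X_A.  Sets where w is tight are closed under union, so A lies in a tight set T; then
-- raising w_i by one violates the constraint at T ∪ {i}, and a minimally dependent vector below the
-- raised one is a circuit u with u_i = 1 supported in A ∪ {i}.  Conversely, given such a circuit,
-- lowering u_i to 0 leaves an independent vector supported in A; if i did not lie in cl_ρ(A) it would
-- add one to the rank of every S ∩ A, which pays for u_i, so u itself would be independent.

module Submission where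

open import Data.Bool using (Bool; true; false; if_then_else_; _∨_)
open import Data.Bool.Properties using (∨-identityʳ)
open import Data.Empty using (⊥-elim)
open import Data.Fin using (Fin; fromℕ<) renaming (zero to fzero; suc to fsuc)
open import Data.Fin.Properties using (any?; ¬∀⟶∃¬)
import Data.Fin.Properties as Fin
open import Data.Fin.Subset using (Subset; _∈_; _∉_; _⊆_; _∪_; _∩_; ⁅_⁆; ⊥; ⊤; ∁; ∣_∣)
open import Data.Fin.Subset.Properties
open import Data.Nat using (ℕ; zero; suc; pred; _+_; _⊓_; _≤_; _<_; z≤n; s≤s; _<?_)
import Data.Nat as ℕ
open import Data.Nat.Properties
open import Algebra.Properties.CommutativeSemigroup +-commutativeSemigroup
  using (interchange; x∙yz≈y∙xz)
open import Data.Product using (∃; _×_; _,_; proj₁)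
open import Data.Product.Properties using (≡-dec; ,-injectiveˡ)
open import Data.Sum using (_⊎_; inj₁; inj₂; [_,_])
open import Data.Vec using (tabulate; lookup; []; _∷_; here; there)
open import Data.Vec.Properties using (tabulate-cong; lookup⇒[]=; []=⇒lookup; lookup∘tabulate)
open import Data.Vec.Functional using (updateAt)
open import Data.Vec.Functional.Properties
  using (updateAt-updates; updateAt-minimal; updateAt-updateAt-local; updateAt-id)
open import Function.Base using (_∘_)
open import Function.Bundles using (_⇔_; mk⇔; Equivalence)
import Function.Properties.Equivalence as ⇔
open import Relation.Binary.PropositionalEquality
  using (_≡_; _≢_; refl; sym; trans; cong; cong₂; subst; module ≡-Reasoning)
open import Relation.Nullary using (¬_; Dec; yes; no; does; contradiction)
open import Relation.Nullary.Decidable using (dec-true; dec-false; decidable-stable; ¬?; _×-dec_)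

open import Defs

open Equivalence using (to; from)

m⊓1+n≡n⇔m≡n : ∀ {m n} → m ⊓ suc n ≡ n ⇔ m ≡ n
m⊓1+n≡n⇔m≡n {m} {n} = mk⇔ to′ from′
  where
  to′ : m ⊓ suc n ≡ n → m ≡ n
  to′ eq with ⊓-sel m (suc n)
  ... | inj₁ m⊓≡m = trans (sym m⊓≡m) eq
  ... | inj₂ m⊓≡1+n = contradiction (trans (sym m⊓≡1+n) eq) 1+n≢n
  from′ : m ≡ n → m ⊓ suc n ≡ n
  from′ refl = m≤n⇒m⊓n≡m (n≤1+n m)

∪-least : ∀ {n} {A B C : Subset n} → A ⊆ C → B ⊆ C → A ∪ B ⊆ C
∪-least {A = A} {B} A⊆C B⊆C x∈A∪B with x∈p∪q⁻ A B x∈A∪B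
... | inj₁ x∈A = A⊆C x∈A
... | inj₂ x∈B = B⊆C x∈B

∪-monoˡ-⊆ : ∀ {n} {A B : Subset n} C → A ⊆ B → A ∪ C ⊆ B ∪ C
∪-monoˡ-⊆ {B = B} C A⊆B = ∪-least (p⊆p∪q C ∘ A⊆B) (q⊆p∪q B C)

⁅⁆⊆ : ∀ {n} {i : Fin n} {A : Subset n} → i ∈ A → ⁅ i ⁆ ⊆ A
⁅⁆⊆ {i = i} {A} i∈A x∈⁅i⁆ = subst (_∈ A) (sym (x∈⁅y⁆⇒x≡y i x∈⁅i⁆)) i∈A

∈tabulate⇔ : ∀ {n} {f : Fin n → Bool} {j} → j ∈ tabulate f ⇔ f j ≡ true
∈tabulate⇔ {f = f} {j} = mk⇔
  (λ j∈ → trans (sym (lookup∘tabulate f j)) ([]=⇒lookup j∈))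
  (λ fj → lookup⇒[]= j _ (trans (lookup∘tabulate f j) fj))

does≡true⇔ : ∀ {P : Set} (P? : Dec P) → does P? ≡ true ⇔ P
does≡true⇔ (yes p) = mk⇔ (λ _ → p) (λ _ → refl)
does≡true⇔ (no ¬p) = mk⇔ (λ ()) (λ p → contradiction p ¬p)

∉⇒lookup≡false : ∀ {n} {A : Subset n} {i} → i ∉ A → lookup A i ≡ false
∉⇒lookup≡false {A = A} {i} i∉A with lookup A i in eq
... | true  = contradiction (lookup⇒[]= i A eq) i∉A
... | false = refl

∪⁅⁆-induction : ∀ {n} (P : Subset n → Set) → P ⊥ →
  (∀ S j → j ∉ S → P S → P (S ∪ ⁅ j ⁆)) → ∀ S → P S
∪⁅⁆-induction {zero} P base step [] = base
∪⁅⁆-induction {suc n} P base step (b ∷ S) = extend b (∪⁅⁆-induction (P ∘ (false ∷_)) base step′ S)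
  where
  step′ : ∀ S′ j → j ∉ S′ → P (false ∷ S′) → P (false ∷ (S′ ∪ ⁅ j ⁆))
  step′ S′ j j∉S′ = step (false ∷ S′) (fsuc j) (j∉S′ ∘ drop-there)
  extend : ∀ b → P (false ∷ S) → P (b ∷ S)
  extend false P[S] = P[S]
  extend true  P[S] = subst (λ T → P (true ∷ T)) (∪-identityʳ S) (step (false ∷ S) fzero (λ ()) P[S])

∣tabulate∣-cong : ∀ {k} {f g : Fin k → Bool} → (∀ x → f x ≡ g x) →
  ∣ tabulate f ∣ ≡ ∣ tabulate g ∣
∣tabulate∣-cong f≗g = cong ∣_∣ (tabulate-cong f≗g)

∣tabulate-const∣ : ∀ k b → ∣ tabulate {n = k} (λ _ → b) ∣ ≡ (if b then k else 0)
∣tabulate-const∣ zero    true  = refl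
∣tabulate-const∣ zero    false = refl
∣tabulate-const∣ (suc k) true  = cong suc (∣tabulate-const∣ k true)
∣tabulate-const∣ (suc k) false = ∣tabulate-const∣ k false

∣tabulate∣≡1 : ∀ {k} (x₀ : Fin k) {f : Fin k → Bool} →
  f x₀ ≡ true → (∀ x → x ≢ x₀ → f x ≡ false) → ∣ tabulate f ∣ ≡ 1
∣tabulate∣≡1 {suc k} fzero {f} fx₀ rest with f fzero
... | true = cong suc (trans (∣tabulate∣-cong (λ x → rest (fsuc x) λ ())) (∣tabulate-const∣ k false))
∣tabulate∣≡1 {suc k} (fsuc x₀) {f} fx₀ rest with f fzero | rest fzero (λ ())
... | false | _ = ∣tabulate∣≡1 x₀ fx₀ (λ x x≢x₀ → rest (fsuc x) (x≢x₀ ∘ Fin.suc-injective))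

sumS-cong : ∀ {n} (S : Subset n) {f g : Fin n → ℕ} → (∀ j → f j ≡ g j) → sumS S f ≡ sumS S g
sumS-cong []          f≗g = refl
sumS-cong (true ∷ S)  f≗g = cong₂ _+_ (f≗g fzero) (sumS-cong S (f≗g ∘ fsuc))
sumS-cong (false ∷ S) f≗g = sumS-cong S (f≗g ∘ fsuc)

sumS-mono : ∀ {n} (S : Subset n) {f g : Fin n → ℕ} →
  (∀ {j} → j ∈ S → f j ≤ g j) → sumS S f ≤ sumS S g
sumS-mono []          f≤g = z≤n
sumS-mono (true ∷ S)  f≤g = +-mono-≤ (f≤g here) (sumS-mono S (f≤g ∘ there))
sumS-mono (false ∷ S) f≤g = sumS-mono S (f≤g ∘ there)

sumS-zero : ∀ {n} (S : Subset n) {f : Fin n → ℕ} → (∀ {j} → j ∈ S → f j ≡ 0) → sumS S f ≡ 0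
sumS-zero []          f≡0 = refl
sumS-zero (true ∷ S)  f≡0 = cong₂ _+_ (f≡0 here) (sumS-zero S (f≡0 ∘ there))
sumS-zero (false ∷ S) f≡0 = sumS-zero S (f≡0 ∘ there)

sumS-⊆ : ∀ {n} {S T : Subset n} (f : Fin n → ℕ) → S ⊆ T → sumS S f ≤ sumS T f
sumS-⊆ {S = []}        {[]}        f S⊆T = z≤n
sumS-⊆ {S = false ∷ S} {false ∷ T} f S⊆T = sumS-⊆ (f ∘ fsuc) (drop-∷-⊆ S⊆T)
sumS-⊆ {S = false ∷ S} {true ∷ T}  f S⊆T =
  ≤-trans (sumS-⊆ (f ∘ fsuc) (drop-∷-⊆ S⊆T)) (m≤n+m _ (f fzero))
sumS-⊆ {S = true ∷ S}  {true ∷ T}  f S⊆T = +-monoʳ-≤ (f fzero) (sumS-⊆ (f ∘ fsuc) (drop-∷-⊆ S⊆T))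
sumS-⊆ {S = true ∷ S}  {false ∷ T} f S⊆T = contradiction (S⊆T here) λ ()

sumS-∪-∩ : ∀ {n} (S T : Subset n) (f : Fin n → ℕ) →
  sumS (S ∪ T) f + sumS (S ∩ T) f ≡ sumS S f + sumS T f
sumS-∪-∩ [] [] f = refl
sumS-∪-∩ (true ∷ S) (true ∷ T) f = begin
  (a + sumS (S ∪ T) g) + (a + sumS (S ∩ T) g) ≡⟨ interchange a (sumS (S ∪ T) g) a (sumS (S ∩ T) g) ⟩
  (a + a) + (sumS (S ∪ T) g + sumS (S ∩ T) g) ≡⟨ cong (a + a +_) (sumS-∪-∩ S T g) ⟩
  (a + a) + (sumS S g + sumS T g)             ≡⟨ interchange a a (sumS S g) (sumS T g) ⟩
  (a + sumS S g) + (a + sumS T g)             ∎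
  where open ≡-Reasoning; a = f fzero; g = f ∘ fsuc
sumS-∪-∩ (true ∷ S) (false ∷ T) f = begin
  (a + sumS (S ∪ T) g) + sumS (S ∩ T) g ≡⟨ +-assoc a _ _ ⟩
  a + (sumS (S ∪ T) g + sumS (S ∩ T) g) ≡⟨ cong (a +_) (sumS-∪-∩ S T g) ⟩
  a + (sumS S g + sumS T g)             ≡⟨ +-assoc a _ _ ⟨
  (a + sumS S g) + sumS T g             ∎
  where open ≡-Reasoning; a = f fzero; g = f ∘ fsuc
sumS-∪-∩ (false ∷ S) (true ∷ T) f = begin
  (a + sumS (S ∪ T) g) + sumS (S ∩ T) g ≡⟨ +-assoc a _ _ ⟩
  a + (sumS (S ∪ T) g + sumS (S ∩ T) g) ≡⟨ cong (a +_) (sumS-∪-∩ S T g) ⟩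
  a + (sumS S g + sumS T g)             ≡⟨ x∙yz≈y∙xz a (sumS S g) (sumS T g) ⟩
  sumS S g + (a + sumS T g)             ∎
  where open ≡-Reasoning; a = f fzero; g = f ∘ fsuc
sumS-∪-∩ (false ∷ S) (false ∷ T) f = sumS-∪-∩ S T (f ∘ fsuc)

sumS-⁅⁆ : ∀ {n} (i : Fin n) (f : Fin n → ℕ) → sumS ⁅ i ⁆ f ≡ f i
sumS-⁅⁆ {suc n} fzero f = trans (cong (f fzero +_) (sumS-zero (⊥ {n}) (⊥-elim ∘ ∉⊥))) (+-identityʳ _)
sumS-⁅⁆ (fsuc i) f = sumS-⁅⁆ i (f ∘ fsuc)

sumS-∪⁅⁆ : ∀ {n} (S : Subset n) {j} (f : Fin n → ℕ) → j ∉ S →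
  sumS (S ∪ ⁅ j ⁆) f ≡ sumS S f + f j
sumS-∪⁅⁆ S {j} f j∉S = begin
  sumS (S ∪ ⁅ j ⁆) f                          ≡⟨ +-identityʳ _ ⟨
  sumS (S ∪ ⁅ j ⁆) f + 0                      ≡⟨ cong (sumS (S ∪ ⁅ j ⁆) f +_) (sumS-zero (S ∩ ⁅ j ⁆) disjoint) ⟨
  sumS (S ∪ ⁅ j ⁆) f + sumS (S ∩ ⁅ j ⁆) f     ≡⟨ sumS-∪-∩ S ⁅ j ⁆ f ⟩
  sumS S f + sumS ⁅ j ⁆ f                     ≡⟨ cong (sumS S f +_) (sumS-⁅⁆ j f) ⟩
  sumS S f + f j                              ∎
  where
  open ≡-Reasoning
  disjoint : ∀ {x} → x ∈ S ∩ ⁅ j ⁆ → f x ≡ 0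
  disjoint x∈ = contradiction (subst (_∈ S) (x∈⁅y⁆⇒x≡y j (p∩q⊆q S _ x∈)) (p∩q⊆p S _ x∈)) j∉S

sumS-∩-support : ∀ {n} (S T : Subset n) {f : Fin n → ℕ} →
  (∀ {j} → j ∉ T → f j ≡ 0) → sumS S f ≡ sumS (S ∩ T) f
sumS-∩-support []          []          f≡0 = refl
sumS-∩-support (true ∷ S)  (true ∷ T)  f≡0 = cong (_ +_) (sumS-∩-support S T (f≡0 ∘ (_∘ drop-there)))
sumS-∩-support (true ∷ S)  (false ∷ T) f≡0 =
  cong₂ _+_ (f≡0 λ ()) (sumS-∩-support S T (f≡0 ∘ (_∘ drop-there)))
sumS-∩-support (false ∷ S) (b ∷ T)     f≡0 = sumS-∩-support S T (f≡0 ∘ (_∘ drop-there))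

sumS-updateAt-∉ : ∀ {n} (S : Subset n) (v : Fin n → ℕ) {k} (f : ℕ → ℕ) →
  k ∉ S → sumS S (updateAt v k f) ≡ sumS S v
sumS-updateAt-∉ (false ∷ S) v {fzero}  f k∉S = refl
sumS-updateAt-∉ (true ∷ S)  v {fzero}  f k∉S = contradiction here k∉S
sumS-updateAt-∉ (false ∷ S) v {fsuc k} f k∉S = sumS-updateAt-∉ S (v ∘ fsuc) f (k∉S ∘ there)
sumS-updateAt-∉ (true ∷ S)  v {fsuc k} f k∉S =
  cong (v fzero +_) (sumS-updateAt-∉ S (v ∘ fsuc) f (k∉S ∘ there))

sumS-updateAt-suc : ∀ {n} (S : Subset n) (v : Fin n → ℕ) {k} →
  k ∈ S → sumS S (updateAt v k suc) ≡ suc (sumS S v)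
sumS-updateAt-suc (true ∷ S)  v {fzero}  here = refl
sumS-updateAt-suc (false ∷ S) v {fsuc k} (there k∈S) = sumS-updateAt-suc S (v ∘ fsuc) k∈S
sumS-updateAt-suc (true ∷ S)  v {fsuc k} (there k∈S) =
  trans (cong (v fzero +_) (sumS-updateAt-suc S (v ∘ fsuc) k∈S)) (+-suc _ _)

updateAt-suc∘pred : ∀ {n} (v : Fin n → ℕ) k → 0 < v k → ∀ j → updateAt (updateAt v k pred) k suc j ≡ v j
updateAt-suc∘pred v k 0<vk j =
  trans (updateAt-updateAt-local k v (suc-pred (v k) {{ℕ.>-nonZero 0<vk}}) j) (updateAt-id k v j)

updateAt-≤ : ∀ {n} (v : Fin n → ℕ) k {f : ℕ → ℕ} → (∀ x → f x ≤ x) →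
  ∀ j → updateAt v k f j ≤ v j
updateAt-≤ v k f≤ j with j Fin.≟ k
... | yes refl = ≤-trans (≤-reflexive (updateAt-updates j v)) (f≤ (v j))
... | no j≢k   = ≤-reflexive (updateAt-minimal j k v j≢k)

minOver-≤ : ∀ n (g : Subset n → ℕ) C → minOver n g ≤ g C
minOver-≤ zero    g []          = ≤-refl
minOver-≤ (suc n) g (false ∷ C) = ≤-trans (m⊓n≤m _ _) (minOver-≤ n _ C)
minOver-≤ (suc n) g (true ∷ C)  = ≤-trans (m⊓n≤n _ _) (minOver-≤ n _ C)

minOver-greatest : ∀ n (g : Subset n → ℕ) {m} → (∀ C → m ≤ g C) → m ≤ minOver n g
minOver-greatest zero    g m≤g = m≤g []
minOver-greatest (suc n) g m≤g =
  ⊓-glb (minOver-greatest n _ (m≤g ∘ (false ∷_))) (minOver-greatest n _ (m≤g ∘ (true ∷_)))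

module _ {n : ℕ} {ρ : Subset n → ℕ} (isPolymatroid : IsPolymatroid ρ) where
  open IsPolymatroid isPolymatroid

  ρ-mono : ∀ {A B} → A ⊆ B → ρ A ≤ ρ B
  ρ-mono = monotone _ _

  ρ-subadditive : ∀ A B → ρ (A ∪ B) ≤ ρ A + ρ B
  ρ-subadditive A B = ≤-trans (m≤m+n _ _) (submodular A B)

  ρ-submodular-⊆ : ∀ {A F} G → A ⊆ F → ρ (F ∪ G) + ρ A ≤ ρ F + ρ (A ∪ G)
  ρ-submodular-⊆ {A} {F} G A⊆F = ≤-trans
    (+-mono-≤ (ρ-mono (∪-least (p⊆p∪q _) (q⊆p∪q F _ ∘ q⊆p∪q A G)))
              (ρ-mono (λ x∈A → x∈p∩q⁺ (A⊆F x∈A , p⊆p∪q G x∈A))))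
    (submodular F (A ∪ G))

  ρ≤sumS : ∀ S → ρ S ≤ sumS S (λ j → ρ ⁅ j ⁆)
  ρ≤sumS = ∪⁅⁆-induction _ (≤-trans (≤-reflexive empty-zero) z≤n) step
    where
    step : ∀ S j → j ∉ S → ρ S ≤ sumS S (λ j → ρ ⁅ j ⁆) →
           ρ (S ∪ ⁅ j ⁆) ≤ sumS (S ∪ ⁅ j ⁆) (λ j → ρ ⁅ j ⁆)
    step S j j∉S ρS≤ = begin
      ρ (S ∪ ⁅ j ⁆)                       ≤⟨ ρ-subadditive S ⁅ j ⁆ ⟩
      ρ S + ρ ⁅ j ⁆                       ≤⟨ +-monoˡ-≤ (ρ ⁅ j ⁆) ρS≤ ⟩
      sumS S (λ j → ρ ⁅ j ⁆) + ρ ⁅ j ⁆    ≡⟨ sumS-∪⁅⁆ S _ j∉S ⟨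
      sumS (S ∪ ⁅ j ⁆) (λ j → ρ ⁅ j ⁆)    ∎
      where open ≤-Reasoning

  Spans : Subset n → Fin n → Set
  Spans A i = ρ (A ∪ ⁅ i ⁆) ≡ ρ A

  Spans-mono : ∀ {A F i} → A ⊆ F → Spans A i → Spans F i
  Spans-mono {A} {F} {i} A⊆F spans = ≤-antisym
    (+-cancelʳ-≤ (ρ A) _ _ (≤-trans (ρ-submodular-⊆ ⁅ i ⁆ A⊆F) (≤-reflexive (cong (ρ F +_) spans))))
    (ρ-mono (p⊆p∪q _))

  ¬Spans⇒< : ∀ {A i} → ¬ Spans A i → ρ A < ρ (A ∪ ⁅ i ⁆)
  ¬Spans⇒< ¬spans = ≤∧≢⇒< (ρ-mono (p⊆p∪q _)) (¬spans ∘ sym)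

  <-∪⁅⁆-antitone : ∀ {A B i} → B ⊆ A → ρ A < ρ (A ∪ ⁅ i ⁆) → ρ B < ρ (B ∪ ⁅ i ⁆)
  <-∪⁅⁆-antitone B⊆A ρA< = ¬Spans⇒< (λ spans → <⇒≢ ρA< (sym (Spans-mono B⊆A spans)))

  ∈⇒Spans : ∀ {A i} → i ∈ A → Spans A i
  ∈⇒Spans i∈A = cong ρ (⊆-antisym (∪-least (λ x∈A → x∈A) (⁅⁆⊆ i∈A)) (p⊆p∪q _))

  loop⇒Spans : ∀ {A i} → ρ ⁅ i ⁆ ≡ 0 → Spans A i
  loop⇒Spans {A} {i} ρi≡0 = ≤-antisym
    (≤-trans (ρ-subadditive A ⁅ i ⁆) (≤-reflexive (trans (cong (ρ A +_) ρi≡0) (+-identityʳ _))))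
    (ρ-mono (p⊆p∪q _))

  Spans⇒∈clρ : ∀ {A i} → Spans A i → _∈clρ_ ρ i A
  Spans⇒∈clρ {A} {i} spans F flat A⊆F with i ∈? F
  ... | yes i∈F = i∈F
  ... | no  i∉F = contradiction (Spans-mono A⊆F spans) (<⇒≢ (flat i i∉F) ∘ sym)

  spanned : Subset n → Subset n
  spanned A = tabulate (λ j → does (ρ (A ∪ ⁅ j ⁆) ℕ.≟ ρ A))

  ∈spanned⇔Spans : ∀ {A j} → j ∈ spanned A ⇔ Spans A j
  ∈spanned⇔Spans {A} {j} = ⇔.trans ∈tabulate⇔
    (does≡true⇔ (ρ (A ∪ ⁅ j ⁆) ℕ.≟ ρ A))

  ⊆spanned : ∀ A → A ⊆ spanned A
  ⊆spanned A = from ∈spanned⇔Spans ∘ ∈⇒Spans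

  ρ-∪-Spans : ∀ A S → (∀ {j} → j ∈ S → Spans A j) → ρ (A ∪ S) ≡ ρ A
  ρ-∪-Spans A = ∪⁅⁆-induction P (λ _ → cong ρ (∪-identityʳ A)) step
    where
    P : Subset n → Set
    P S = (∀ {j} → j ∈ S → Spans A j) → ρ (A ∪ S) ≡ ρ A
    step : ∀ S j → j ∉ S → P S → P (S ∪ ⁅ j ⁆)
    step S j _ ih spans = begin
      ρ (A ∪ (S ∪ ⁅ j ⁆))  ≡⟨ cong ρ (∪-assoc A S ⁅ j ⁆) ⟨
      ρ ((A ∪ S) ∪ ⁅ j ⁆)  ≡⟨ Spans-mono (p⊆p∪q S) (spans (q⊆p∪q S _ (x∈⁅x⁆ j))) ⟩
      ρ (A ∪ S)            ≡⟨ ih (spans ∘ p⊆p∪q ⁅ j ⁆) ⟩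
      ρ A                  ∎
      where open ≡-Reasoning

  ρ-spanned : ∀ A → ρ (spanned A) ≡ ρ A
  ρ-spanned A = ≤-antisym
    (≤-trans (ρ-mono (q⊆p∪q A _)) (≤-reflexive (ρ-∪-Spans A (spanned A) (to ∈spanned⇔Spans))))
    (ρ-mono (⊆spanned A))

  spanned-isFlat : ∀ A → IsFlat ρ (spanned A)
  spanned-isFlat A j j∉ = begin-strict
    ρ (spanned A)           ≡⟨ ρ-spanned A ⟩
    ρ A                     <⟨ ¬Spans⇒< (j∉ ∘ from ∈spanned⇔Spans) ⟩
    ρ (A ∪ ⁅ j ⁆)           ≤⟨ ρ-mono (∪-monoˡ-⊆ ⁅ j ⁆ (⊆spanned A)) ⟩
    ρ (spanned A ∪ ⁅ j ⁆)   ∎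
    where open ≤-Reasoning

  ∈clρ⇔Spans : ∀ {A i} → _∈clρ_ ρ i A ⇔ Spans A i
  ∈clρ⇔Spans {A} = mk⇔
    (λ i∈cl → to ∈spanned⇔Spans (i∈cl (spanned A) (spanned-isFlat A) (⊆spanned A)))
    Spans⇒∈clρ

  capacity : Subset n → Fin n → ℕ
  capacity A j = if lookup A j then ρ ⁅ j ⁆ else 0

  capacity-∈ : ∀ {A j} → j ∈ A → capacity A j ≡ ρ ⁅ j ⁆
  capacity-∈ j∈A rewrite []=⇒lookup j∈A = refl

  capacity-∉ : ∀ {A j} → j ∉ A → capacity A j ≡ 0
  capacity-∉ j∉A rewrite ∉⇒lookup≡false j∉A = refl

  capacity-≤ : ∀ A j → capacity A j ≤ ρ ⁅ j ⁆
  capacity-≤ A j with lookup A j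
  ... | true  = ≤-refl
  ... | false = z≤n

  blockCount : SubE' ρ → Fin n → ℕ
  blockCount Y j = ∣ tabulate (λ x → Y (j , x)) ∣

  blockCount-X : ∀ A j → blockCount (X ρ A) j ≡ capacity A j
  blockCount-X A j = ∣tabulate-const∣ (ρ ⁅ j ⁆) (lookup A j)

  rankM-≤ : ∀ {Y c} → (∀ j → blockCount Y j ≡ c j) → ∀ C → rankM ρ Y ≤ ρ C + sumS (∁ C) c
  rankM-≤ {Y} count C = ≤-trans (minOver-≤ n _ C) (≤-reflexive (cong (ρ C +_) (sumS-cong (∁ C) count)))

  ≤-rankM : ∀ {Y c m} → (∀ j → blockCount Y j ≡ c j) →
    (∀ C → m ≤ ρ C + sumS (∁ C) c) → m ≤ rankM ρ Y
  ≤-rankM {Y} count m≤ = minOver-greatest n _ λ C →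
    ≤-trans (m≤ C) (≤-reflexive (cong (ρ C +_) (sym (sumS-cong (∁ C) count))))

  ρ≤ρ+sumS-∁ : ∀ {A} C (g : Fin n → ℕ) → (∀ {j} → j ∈ A → j ∉ C → ρ ⁅ j ⁆ ≤ g j) →
    ρ A ≤ ρ C + sumS (∁ C) g
  ρ≤ρ+sumS-∁ {A} C g ρ≤g = begin
    ρ A                                      ≤⟨ ρ-mono A⊆ ⟩
    ρ (C ∪ (∁ C ∩ A))                        ≤⟨ ρ-subadditive C _ ⟩
    ρ C + ρ (∁ C ∩ A)                        ≤⟨ +-monoʳ-≤ (ρ C) (ρ≤sumS _) ⟩
    ρ C + sumS (∁ C ∩ A) (λ j → ρ ⁅ j ⁆)     ≤⟨ +-monoʳ-≤ (ρ C) (sumS-mono _ ρ≤g′) ⟩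
    ρ C + sumS (∁ C ∩ A) g                   ≤⟨ +-monoʳ-≤ (ρ C) (sumS-⊆ g (p∩q⊆p (∁ C) A)) ⟩
    ρ C + sumS (∁ C) g                       ∎
    where
    open ≤-Reasoning
    A⊆ : A ⊆ C ∪ (∁ C ∩ A)
    A⊆ {x} x∈A with x ∈? C
    ... | yes x∈C = p⊆p∪q _ x∈C
    ... | no  x∉C = q⊆p∪q C _ (x∈p∩q⁺ (x∉p⇒x∈∁p x∉C , x∈A))
    ρ≤g′ : ∀ {j} → j ∈ ∁ C ∩ A → ρ ⁅ j ⁆ ≤ g j
    ρ≤g′ j∈ with x∈p∩q⁻ (∁ C) A j∈
    ... | j∈∁C , j∈A = ρ≤g j∈A (x∈∁p⇒x∉p j∈∁C)

  rankM-capacity : ∀ A {Y} → (∀ j → blockCount Y j ≡ capacity A j) → rankM ρ Y ≡ ρ A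
  rankM-capacity A count = ≤-antisym
    (≤-trans (rankM-≤ count A) (≤-reflexive
      (trans (cong (ρ A +_) (sumS-zero (∁ A) (capacity-∉ ∘ x∈∁p⇒x∉p))) (+-identityʳ _))))
    (≤-rankM count λ C → ρ≤ρ+sumS-∁ C _ λ j∈A _ → ≤-reflexive (sym (capacity-∈ j∈A)))

  rankM-capacity+1 : ∀ {A i} → i ∉ A →
    ∀ {Y} → (∀ j → blockCount Y j ≡ updateAt (capacity A) i suc j) →
    rankM ρ Y ≡ ρ (A ∪ ⁅ i ⁆) ⊓ suc (ρ A)
  rankM-capacity+1 {A} {i} i∉A count = ≤-antisym (⊓-glb upper₁ upper₂) (≤-rankM count lower)
    where
    c : Fin n → ℕ
    c = updateAt (capacity A) i suc
    sumS-∁A : sumS (∁ A) c ≡ 1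
    sumS-∁A = trans (sumS-updateAt-suc (∁ A) _ (x∉p⇒x∈∁p i∉A))
                    (cong suc (sumS-zero (∁ A) (capacity-∉ ∘ x∈∁p⇒x∉p)))
    sumS-∁A∪i : sumS (∁ (A ∪ ⁅ i ⁆)) c ≡ 0
    sumS-∁A∪i = trans
      (sumS-updateAt-∉ (∁ (A ∪ ⁅ i ⁆)) _ suc (λ i∈ → x∈∁p⇒x∉p i∈ (q⊆p∪q A _ (x∈⁅x⁆ i))))
      (sumS-zero (∁ (A ∪ ⁅ i ⁆)) λ j∈ → capacity-∉ (x∈∁p⇒x∉p j∈ ∘ p⊆p∪q ⁅ i ⁆))
    upper₁ : rankM ρ _ ≤ ρ (A ∪ ⁅ i ⁆)
    upper₁ = ≤-trans (rankM-≤ count (A ∪ ⁅ i ⁆))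
                     (≤-reflexive (trans (cong (ρ (A ∪ ⁅ i ⁆) +_) sumS-∁A∪i) (+-identityʳ _)))
    upper₂ : rankM ρ _ ≤ suc (ρ A)
    upper₂ = ≤-trans (rankM-≤ count A) (≤-reflexive (trans (cong (ρ A +_) sumS-∁A) (+-comm (ρ A) 1)))
    lower : ∀ C → ρ (A ∪ ⁅ i ⁆) ⊓ suc (ρ A) ≤ ρ C + sumS (∁ C) c
    lower C with i ∈? C
    ... | yes i∈C = ≤-trans (m⊓n≤m _ _) (ρ≤ρ+sumS-∁ C c ρ≤c)
      where
      ρ≤c : ∀ {j} → j ∈ A ∪ ⁅ i ⁆ → j ∉ C → ρ ⁅ j ⁆ ≤ c j
      ρ≤c {j} j∈ j∉C with x∈p∪q⁻ A _ j∈
      ... | inj₂ j∈⁅i⁆ = contradiction (subst (_∈ C) (sym (x∈⁅y⁆⇒x≡y i j∈⁅i⁆)) i∈C) j∉C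
      ... | inj₁ j∈A = ≤-reflexive (sym (trans (updateAt-minimal j i _ j≢i) (capacity-∈ j∈A)))
        where
        j≢i : j ≢ i
        j≢i j≡i = j∉C (subst (_∈ C) (sym j≡i) i∈C)
    ... | no i∉C = ≤-trans (m⊓n≤n _ _) (begin
      suc (ρ A)                           ≤⟨ s≤s (ρ≤ρ+sumS-∁ C _ λ j∈A _ → ≤-reflexive (sym (capacity-∈ j∈A))) ⟩
      suc (ρ C + sumS (∁ C) (capacity A)) ≡⟨ +-suc (ρ C) _ ⟨
      ρ C + suc (sumS (∁ C) (capacity A)) ≡⟨ cong (ρ C +_) (sumS-updateAt-suc (∁ C) _ (x∉p⇒x∈∁p i∉C)) ⟨
      ρ C + sumS (∁ C) c                  ∎)
      where open ≤-Reasoning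

  insert-∈ : ∀ {A i} (x₀ : Fin (ρ ⁅ i ⁆)) → i ∈ A → ∀ e → insert ρ (i , x₀) (X ρ A) e ≡ X ρ A e
  insert-∈ {A} {i} x₀ i∈A (j , x) with j ∈? A
  ... | yes j∈A rewrite []=⇒lookup j∈A = refl
  ... | no  j∉A rewrite ∉⇒lookup≡false j∉A = dec-false (≡-dec Fin._≟_ Fin._≟_ (j , x) (i , x₀))
    λ e≡ → j∉A (subst (_∈ A) (sym (,-injectiveˡ e≡)) i∈A)

  insert-other-block : ∀ {i j} (x₀ : Fin (ρ ⁅ i ⁆)) (Y : SubE' ρ) → j ≢ i → ∀ x →
    insert ρ (i , x₀) Y (j , x) ≡ Y (j , x)
  insert-other-block {i} {j} x₀ Y j≢i x =
    trans (cong (Y (j , x) ∨_) (dec-false (≡-dec Fin._≟_ Fin._≟_ (j , x) (i , x₀)) (j≢i ∘ ,-injectiveˡ)))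
          (∨-identityʳ _)

  blockCount-insert-self : ∀ {A i} (x₀ : Fin (ρ ⁅ i ⁆)) → i ∉ A →
    blockCount (insert ρ (i , x₀) (X ρ A)) i ≡ 1
  blockCount-insert-self {A} {i} x₀ i∉A = ∣tabulate∣≡1 x₀ hit miss
    where
    hit : insert ρ (i , x₀) (X ρ A) (i , x₀) ≡ true
    hit rewrite ∉⇒lookup≡false i∉A = dec-true (≡-dec Fin._≟_ Fin._≟_ (i , x₀) (i , x₀)) refl
    miss : ∀ x → x ≢ x₀ → insert ρ (i , x₀) (X ρ A) (i , x) ≡ false
    miss x x≢x₀ rewrite ∉⇒lookup≡false i∉A =
      dec-false (≡-dec Fin._≟_ Fin._≟_ (i , x) (i , x₀)) λ { refl → x≢x₀ refl }

  blockCount-insert-∉ : ∀ {A i} (x₀ : Fin (ρ ⁅ i ⁆)) → i ∉ A →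
    ∀ j → blockCount (insert ρ (i , x₀) (X ρ A)) j ≡ updateAt (capacity A) i suc j
  blockCount-insert-∉ {A} {i} x₀ i∉A j = by-cases (j Fin.≟ i)
    where
    open ≡-Reasoning
    by-cases : Dec (j ≡ i) → blockCount (insert ρ (i , x₀) (X ρ A)) j ≡ updateAt (capacity A) i suc j
    by-cases (no j≢i) = begin
      blockCount (insert ρ (i , x₀) (X ρ A)) j ≡⟨ ∣tabulate∣-cong (insert-other-block x₀ (X ρ A) j≢i) ⟩
      blockCount (X ρ A) j                    ≡⟨ blockCount-X A j ⟩
      capacity A j                            ≡⟨ updateAt-minimal j i _ j≢i ⟨
      updateAt (capacity A) i suc j           ∎
    by-cases (yes j≡i) = subst (λ k → blockCount (insert ρ (i , x₀) (X ρ A)) k ≡ updateAt (capacity A) i suc k)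
      (sym j≡i) (begin
      blockCount (insert ρ (i , x₀) (X ρ A)) i ≡⟨ blockCount-insert-self x₀ i∉A ⟩
      1                                        ≡⟨ cong suc (capacity-∉ i∉A) ⟨
      suc (capacity A i)                       ≡⟨ updateAt-updates i _ ⟨
      updateAt (capacity A) i suc i            ∎)

  ∈clM⇔Spans : ∀ A (e : E' ρ) → _∈clM_ ρ e (X ρ A) ⇔ Spans A (proj₁ e)
  ∈clM⇔Spans A (i , x₀) with i ∈? A
  ... | yes i∈A = mk⇔ (λ _ → ∈⇒Spans i∈A) λ _ → begin
    rankM ρ (insert ρ (i , x₀) (X ρ A)) ≡⟨ rankM-capacity A count ⟩
    ρ A                                 ≡⟨ rankM-capacity A (blockCount-X A) ⟨
    rankM ρ (X ρ A)                     ∎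
    where
    open ≡-Reasoning
    count : ∀ j → blockCount (insert ρ (i , x₀) (X ρ A)) j ≡ capacity A j
    count j = trans (∣tabulate∣-cong (insert-∈ x₀ i∈A ∘ (j ,_))) (blockCount-X A j)
  ... | no i∉A = ⇔.trans (mk⇔ (λ eq → trans (sym rank+1) (trans eq rank))
                             (λ eq → trans rank+1 (trans eq (sym rank))))
                         m⊓1+n≡n⇔m≡n
    where
    rank+1 : rankM ρ (insert ρ (i , x₀) (X ρ A)) ≡ ρ (A ∪ ⁅ i ⁆) ⊓ suc (ρ A)
    rank+1 = rankM-capacity+1 i∉A (blockCount-insert-∉ x₀ i∉A)
    rank : rankM ρ (X ρ A) ≡ ρ A
    rank = rankM-capacity A (blockCount-X A)

  cl≡⇔clM≡ : ∀ (A B : Subset n) →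
    (∀ i → _∈clρ_ ρ i A ⇔ i ∈ B) ⇔
    ((∀ i → _∈hat0 ρ i → i ∈ B) × (∀ (e : E' ρ) → _∈clM_ ρ e (X ρ A) ⇔ (X ρ B e ≡ true)))
  cl≡⇔clM≡ A B = mk⇔ to′ from′
    where
    ∈B⇔ : ∀ {i} → i ∈ B ⇔ (lookup B i ≡ true)
    ∈B⇔ {i} = mk⇔ []=⇒lookup (lookup⇒[]= i B)
    to′ : (∀ i → _∈clρ_ ρ i A ⇔ i ∈ B) →
          (∀ i → _∈hat0 ρ i → i ∈ B) × (∀ e → _∈clM_ ρ e (X ρ A) ⇔ (X ρ B e ≡ true))
    to′ cl≡B = (λ i ρi≡0 → to (cl≡B i) (Spans⇒∈clρ (loop⇒Spans ρi≡0)))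
             , (λ { (i , x) → ⇔.trans (∈clM⇔Spans A (i , x))
                                (⇔.trans (⇔.sym ∈clρ⇔Spans) (⇔.trans (cl≡B i) ∈B⇔)) })
    from′ : (∀ i → _∈hat0 ρ i → i ∈ B) × (∀ e → _∈clM_ ρ e (X ρ A) ⇔ (X ρ B e ≡ true)) →
            ∀ i → _∈clρ_ ρ i A ⇔ i ∈ B
    from′ (loops⊆B , clM≡XB) i with ρ ⁅ i ⁆ ℕ.≟ 0
    ... | yes ρi≡0 = mk⇔ (λ _ → loops⊆B i ρi≡0) (λ _ → Spans⇒∈clρ (loop⇒Spans ρi≡0))
    ... | no ρi≢0 = ⇔.trans ∈clρ⇔Spans
                      (⇔.trans (⇔.sym (∈clM⇔Spans A e)) (⇔.trans (clM≡XB e) (⇔.sym ∈B⇔)))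
      where
      e : E' ρ
      e = i , fromℕ< (n≢0⇒n>0 ρi≢0)

  Tight : (Fin n → ℕ) → Subset n → Set
  Tight w T = ρ T ≤ sumS T w

  independent? : ∀ u → Dec (Independent ρ u)
  independent? u with anySubset? (λ S → ρ S <? sumS S u)
  ... | yes (S , violated) = no λ ind → <⇒≱ violated (ind S)
  ... | no  ¬violated      = yes λ S → ≮⇒≥ (¬violated ∘ (S ,_))

  dependent⇒violated : ∀ {u} → ¬ Independent ρ u → ∃ λ S → ρ S < sumS S u
  dependent⇒violated {u} dep with anySubset? (λ S → ρ S <? sumS S u)
  ... | yes violation = violation
  ... | no  ¬violated = contradiction (λ S → ≮⇒≥ (¬violated ∘ (S ,_))) dep

  independent-≤ : ∀ {u w} → (∀ j → w j ≤ u j) → Independent ρ u → Independent ρ w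
  independent-≤ w≤u ind S = ≤-trans (sumS-mono S (λ {j} _ → w≤u j)) (ind S)

  total : (Fin n → ℕ) → ℕ
  total = sumS ⊤

  total-updateAt-suc : ∀ v j → total (updateAt v j suc) ≡ suc (total v)
  total-updateAt-suc v j = sumS-updateAt-suc ⊤ v ∈⊤

  record MaximalIndependentBelow (c w : Fin n → ℕ) : Set where
    field
      independent : Independent ρ w
      below       : ∀ j → w j ≤ c j
      saturated   : ∀ j → w j < c j → ¬ Independent ρ (updateAt w j suc)

  maximalIndependentBelow : ∀ c → ∃ (MaximalIndependentBelow c)
  maximalIndependentBelow c =
    grow (total c) (λ _ → 0) zero-independent (λ _ → z≤n) (m≤n+m _ _)
    where
    raise-≤ : ∀ {w j} → (∀ k → w k ≤ c k) → w j < c j → ∀ k → updateAt w j suc k ≤ c k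
    raise-≤ {w} {j} w≤c w<c k with k Fin.≟ j
    ... | yes refl = ≤-trans (≤-reflexive (updateAt-updates k w)) w<c
    ... | no k≢j   = ≤-trans (≤-reflexive (updateAt-minimal k j w k≢j)) (w≤c k)
    zero-independent : Independent ρ (λ _ → 0)
    zero-independent S = ≤-trans (≤-reflexive (sumS-zero S λ _ → refl)) z≤n
    -- k is fuel: it bounds the gap between total c and total w, and each extension closes it by one.
    grow : ∀ k w → Independent ρ w → (∀ j → w j ≤ c j) → total c ≤ total w + k →
           ∃ (MaximalIndependentBelow c)
    grow k w ind w≤c bound with any? (λ j → (w j <? c j) ×-dec independent? (updateAt w j suc))
    ... | no stuck = w , record
      { independent = ind ; below = w≤c ; saturated = λ j w<c ind′ → stuck (j , w<c , ind′) }
    grow zero w ind w≤c bound | yes (j , w<c , _) = contradiction bound (<⇒≱ (begin-strict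
      total w + 0                  ≡⟨ +-identityʳ _ ⟩
      total w                      <⟨ n<1+n _ ⟩
      suc (total w)                ≡⟨ total-updateAt-suc w j ⟨
      total (updateAt w j suc)     ≤⟨ sumS-mono ⊤ (λ {k} _ → raise-≤ w≤c w<c k) ⟩
      total c                      ∎))
      where open ≤-Reasoning
    grow (suc k) w ind w≤c bound | yes (j , w<c , ind′) =
      grow k (updateAt w j suc) ind′ (raise-≤ w≤c w<c)
        (≤-trans bound (≤-reflexive (trans (+-suc _ k) (cong (_+ k) (sym (total-updateAt-suc w j))))))

  record MinimallyDependent (u : Fin n → ℕ) : Set where
    field
      dependent : ¬ Independent ρ u
      minimal   : ∀ k → 0 < u k → Independent ρ (updateAt u k pred)

  minimallyDependentBelow : ∀ v → ¬ Independent ρ v → ∃ λ u → (∀ j → u j ≤ v j) × MinimallyDependent u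
  minimallyDependentBelow v dep = shrink (total v) v dep ≤-refl
    where
    total-pred : ∀ v k → 0 < v k → suc (total (updateAt v k pred)) ≡ total v
    total-pred v k 0<vk = trans (sym (total-updateAt-suc _ k)) (sumS-cong ⊤ (updateAt-suc∘pred v k 0<vk))
    shrink : ∀ m v → ¬ Independent ρ v → total v ≤ m →
             ∃ λ u → (∀ j → u j ≤ v j) × MinimallyDependent u
    shrink m v dep bound with any? (λ k → (0 <? v k) ×-dec ¬? (independent? (updateAt v k pred)))
    ... | no stuck = v , (λ _ → ≤-refl) , record
      { dependent = dep
      ; minimal = λ k 0<vk → decidable-stable (independent? _) (stuck ∘ (k ,_) ∘ (0<vk ,_)) }
    shrink zero v dep bound | yes (k , 0<vk , _) =
      contradiction (≤-trans (≤-reflexive (total-pred v k 0<vk)) bound) λ ()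
    shrink (suc m) v dep bound | yes (k , 0<vk , dep′)
      with shrink m (updateAt v k pred) dep′ (≤-pred (≤-trans (≤-reflexive (total-pred v k 0<vk)) bound))
    ... | u , u≤ , minDep = u , (λ j → ≤-trans (u≤ j) (updateAt-≤ v k (λ _ → pred[n]≤n) j)) , minDep

  minimallyDependent⇒minimal : ∀ {u} → MinimallyDependent u →
    ∀ w → (∀ i → w i ≤ u i) → ¬ (∀ i → w i ≡ u i) → Independent ρ w
  minimallyDependent⇒minimal {u} minDep w w≤u w≢u with ¬∀⟶∃¬ n _ (λ i → w i ℕ.≟ u i) w≢u
  ... | k , wk≢uk = independent-≤ w≤u′ (MinimallyDependent.minimal minDep k (≤-<-trans z≤n wk<uk))
    where
    wk<uk : w k < u k
    wk<uk = ≤∧≢⇒< (w≤u k) wk≢uk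
    w≤u′ : ∀ i → w i ≤ updateAt u k pred i
    w≤u′ i with i Fin.≟ k
    ... | yes refl = ≤-trans (<⇒≤pred wk<uk) (≤-reflexive (sym (updateAt-updates i u)))
    ... | no i≢k   = ≤-trans (w≤u i) (≤-reflexive (sym (updateAt-minimal i k u i≢k)))

  tight-∪ : ∀ {w S T} → Independent ρ w → Tight w S → Tight w T → Tight w (S ∪ T)
  tight-∪ {w} {S} {T} ind tight-S tight-T = +-cancelʳ-≤ (ρ (S ∩ T)) _ _ (begin
    ρ (S ∪ T) + ρ (S ∩ T)             ≤⟨ submodular S T ⟩
    ρ S + ρ T                         ≤⟨ +-mono-≤ tight-S tight-T ⟩
    sumS S w + sumS T w               ≡⟨ sumS-∪-∩ S T w ⟨
    sumS (S ∪ T) w + sumS (S ∩ T) w   ≤⟨ +-monoʳ-≤ (sumS (S ∪ T) w) (ind (S ∩ T)) ⟩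
    sumS (S ∪ T) w + ρ (S ∩ T)        ∎)
    where open ≤-Reasoning

  tight-∋ : ∀ {c w j} → MaximalIndependentBelow c w → ρ ⁅ j ⁆ ≤ c j → ∃ λ T → j ∈ T × Tight w T
  tight-∋ {c} {w} {j} max ρj≤cj with w j <? c j
  ... | no wj≮cj =
    ⁅ j ⁆ , x∈⁅x⁆ j , ≤-trans ρj≤cj (≤-trans (≮⇒≥ wj≮cj) (≤-reflexive (sym (sumS-⁅⁆ j w))))
  ... | yes wj<cj with dependent⇒violated (MaximalIndependentBelow.saturated max j wj<cj)
  ...   | S , violated with j ∈? S
  ...     | yes j∈S = S , j∈S , ≤-pred (≤-trans violated (≤-reflexive (sumS-updateAt-suc S w j∈S)))
  ...     | no  j∉S = contradiction (MaximalIndependentBelow.independent max S)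
                        (<⇒≱ (≤-trans violated (≤-reflexive (sumS-updateAt-∉ S w suc j∉S))))

  tight-⊇ : ∀ {c w} → MaximalIndependentBelow c w →
    ∀ S → (∀ {j} → j ∈ S → ρ ⁅ j ⁆ ≤ c j) → ∃ λ T → S ⊆ T × Tight w T
  tight-⊇ {c} {w} max = ∪⁅⁆-induction P base step
    where
    P : Subset n → Set
    P S = (∀ {j} → j ∈ S → ρ ⁅ j ⁆ ≤ c j) → ∃ λ T → S ⊆ T × Tight w T
    base : P ⊥
    base _ = ⊥ , (λ x∈⊥ → x∈⊥) , ≤-trans (≤-reflexive empty-zero) z≤n
    step : ∀ S j → j ∉ S → P S → P (S ∪ ⁅ j ⁆)
    step S j _ ih ρ≤c with ih (ρ≤c ∘ p⊆p∪q _) | tight-∋ max (ρ≤c (q⊆p∪q S _ (x∈⁅x⁆ j)))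
    ... | T , S⊆T , tight-T | T′ , j∈T′ , tight-T′ =
      T ∪ T′ , ∪-least (p⊆p∪q T′ ∘ S⊆T) (q⊆p∪q T T′ ∘ ⁅⁆⊆ j∈T′) ,
      tight-∪ (MaximalIndependentBelow.independent max) tight-T tight-T′

  Spans⇒raise-dependent : ∀ {A T i w} → Spans A i → A ⊆ T → Tight w T → ¬ Independent ρ (updateAt w i suc)
  Spans⇒raise-dependent {A} {T} {i} {w} spans A⊆T tight ind = <⇒≱ violated (ind (T ∪ ⁅ i ⁆))
    where
    open ≤-Reasoning
    violated : ρ (T ∪ ⁅ i ⁆) < sumS (T ∪ ⁅ i ⁆) (updateAt w i suc)
    violated = begin-strict
      ρ (T ∪ ⁅ i ⁆)                        ≡⟨ Spans-mono A⊆T spans ⟩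
      ρ T                                  ≤⟨ tight ⟩
      sumS T w                             ≤⟨ sumS-⊆ w (p⊆p∪q {p = T} ⁅ i ⁆) ⟩
      sumS (T ∪ ⁅ i ⁆) w                   <⟨ n<1+n _ ⟩
      suc (sumS (T ∪ ⁅ i ⁆) w)             ≡⟨ sumS-updateAt-suc (T ∪ ⁅ i ⁆) w (q⊆p∪q T _ (x∈⁅x⁆ i)) ⟨
      sumS (T ∪ ⁅ i ⁆) (updateAt w i suc)  ∎

  circuit-below-raise : ∀ {A i w u} → i ∉ A → ρ ⁅ i ⁆ ≢ 0 →
    Independent ρ w → (∀ j → w j ≤ capacity A j) →
    (∀ j → u j ≤ updateAt w i suc j) → MinimallyDependent u →
    IsCircuit ρ u × u i ≡ 1 × (∀ j → j ∉ A → j ≢ i → u j ≡ 0)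
  circuit-below-raise {A} {i} {w} {u} i∉A ρi≢0 ind w≤cap u≤ minDep =
    (u≤ρ , dependent , minimallyDependent⇒minimal minDep) , ui≡1 , zero-outside
    where
    open MinimallyDependent minDep
    u≤w : ∀ {j} → j ≢ i → u j ≤ w j
    u≤w {j} j≢i = ≤-trans (u≤ j) (≤-reflexive (updateAt-minimal j i w j≢i))
    wi≡0 : w i ≡ 0
    wi≡0 = n≤0⇒n≡0 (≤-trans (w≤cap i) (≤-reflexive (capacity-∉ i∉A)))
    ui≢0 : u i ≢ 0
    ui≢0 ui≡0 = dependent (independent-≤ u≤w′ ind)
      where
      u≤w′ : ∀ j → u j ≤ w j
      u≤w′ j with j Fin.≟ i
      ... | yes refl = ≤-trans (≤-reflexive ui≡0) z≤n
      ... | no j≢i   = u≤w j≢i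
    ui≡1 : u i ≡ 1
    ui≡1 = ≤-antisym (≤-trans (u≤ i) (≤-reflexive (trans (updateAt-updates i w) (cong suc wi≡0))))
                     (n≢0⇒n>0 ui≢0)
    u≤ρ : ∀ j → u j ≤ ρ ⁅ j ⁆
    u≤ρ j with j Fin.≟ i
    ... | yes refl = ≤-trans (≤-reflexive ui≡1) (n≢0⇒n>0 ρi≢0)
    ... | no j≢i   = ≤-trans (u≤w j≢i) (≤-trans (w≤cap j) (capacity-≤ A j))
    zero-outside : ∀ j → j ∉ A → j ≢ i → u j ≡ 0
    zero-outside j j∉A j≢i =
      n≤0⇒n≡0 (≤-trans (u≤w j≢i) (≤-trans (w≤cap j) (≤-reflexive (capacity-∉ j∉A))))

  Spans⇒∈C : ∀ {A i} → Spans A i → i ∉ A → ρ ⁅ i ⁆ ≢ 0 → _∈C_ ρ i A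
  Spans⇒∈C {A} {i} spans i∉A ρi≢0
    with maximalIndependentBelow (capacity A)
  ... | w , max
    with tight-⊇ max A (λ j∈A → ≤-reflexive (sym (capacity-∈ j∈A)))
  ... | T , A⊆T , tight
    with minimallyDependentBelow _ (Spans⇒raise-dependent spans A⊆T tight)
  ... | u , u≤ , minDep = u , circuit-below-raise i∉A ρi≢0 independent below u≤ minDep
    where open MaximalIndependentBelow max

  ∈C⇒Spans : ∀ {A i} → _∈C_ ρ i A → Spans A i
  ∈C⇒Spans {A} {i} (u , (_ , dependent , minimal) , ui≡1 , zero-outside) with ρ (A ∪ ⁅ i ⁆) ℕ.≟ ρ A
  ... | yes spans = spans
  ... | no ¬spans = contradiction independent dependent
    where
    u′ : Fin n → ℕ
    u′ = updateAt u i pred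
    u′i≡0 : u′ i ≡ 0
    u′i≡0 = trans (updateAt-updates i u) (cong pred ui≡1)
    u′-independent : Independent ρ u′
    u′-independent = minimal u′ (updateAt-≤ u i (λ _ → pred[n]≤n))
      (λ u′≗u → 0≢1+n (trans (sym u′i≡0) (trans (u′≗u i) ui≡1)))
    u′-support : ∀ {j} → j ∉ A → u′ j ≡ 0
    u′-support {j} j∉A with j Fin.≟ i
    ... | yes refl = u′i≡0
    ... | no j≢i   = trans (updateAt-minimal j i u j≢i) (zero-outside j j∉A j≢i)
    u≗raise-u′ : ∀ j → u j ≡ updateAt u′ i suc j
    u≗raise-u′ j = sym (updateAt-suc∘pred u i (≤-reflexive (sym ui≡1)) j)
    independent : Independent ρ u
    independent S with i ∈? S
    ... | no i∉S = begin
      sumS S u                      ≡⟨ sumS-cong S u≗raise-u′ ⟩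
      sumS S (updateAt u′ i suc)    ≡⟨ sumS-updateAt-∉ S u′ suc i∉S ⟩
      sumS S u′                     ≤⟨ u′-independent S ⟩
      ρ S                           ∎
      where open ≤-Reasoning
    ... | yes i∈S = begin
      sumS S u                      ≡⟨ sumS-cong S u≗raise-u′ ⟩
      sumS S (updateAt u′ i suc)    ≡⟨ sumS-updateAt-suc S u′ i∈S ⟩
      suc (sumS S u′)               ≡⟨ cong suc (sumS-∩-support S A u′-support) ⟩
      suc (sumS (S ∩ A) u′)         ≤⟨ s≤s (u′-independent (S ∩ A)) ⟩
      suc (ρ (S ∩ A))               ≤⟨ <-∪⁅⁆-antitone (p∩q⊆q S A) (¬Spans⇒< ¬spans) ⟩
      ρ ((S ∩ A) ∪ ⁅ i ⁆)           ≤⟨ ρ-mono (∪-least (p∩q⊆p S A) (⁅⁆⊆ i∈S)) ⟩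
      ρ S                           ∎
      where open ≤-Reasoning

  cl≡A∪loops∪C : ∀ A i → _∈clρ_ ρ i A ⇔ (i ∈ A ⊎ _∈hat0 ρ i ⊎ _∈C_ ρ i A)
  cl≡A∪loops∪C A i = ⇔.trans ∈clρ⇔Spans (mk⇔ to′ [ ∈⇒Spans , [ loop⇒Spans , ∈C⇒Spans ] ])
    where
    to′ : Spans A i → i ∈ A ⊎ _∈hat0 ρ i ⊎ _∈C_ ρ i A
    to′ spans with i ∈? A | ρ ⁅ i ⁆ ℕ.≟ 0
    ... | yes i∈A | _         = inj₁ i∈A
    ... | no  i∉A | yes ρi≡0  = inj₂ (inj₁ ρi≡0)
    ... | no  i∉A | no  ρi≢0  = inj₂ (inj₂ (Spans⇒∈C spans i∉A ρi≢0))

lemma5p7 : (n : ℕ) (ρ : Subset n → ℕ) → IsPolymatroid ρ →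
    (∀ (A B : Subset n) →
      (∀ i → (_∈clρ_ ρ i A) ⇔ (i ∈ B)) ⇔
      ((∀ i → _∈hat0 ρ i → i ∈ B) ×
       (∀ (e : E' ρ) → (_∈clM_ ρ e (X ρ A)) ⇔ (X ρ B e ≡ true))))
    ×
    (∀ (A : Subset n) (i : Fin n) →
      (_∈clρ_ ρ i A) ⇔ (i ∈ A ⊎ _∈hat0 ρ i ⊎ _∈C_ ρ i A))
lemma5p7 n ρ isPolymatroid = cl≡⇔clM≡ isPolymatroid , cl≡A∪loops∪C isPolymatroid
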